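{- The modal logics $\mathsf{EC}$ and $\mathsf{ECN}$ do not have Craig interpolation (CIP). As a consequence, they have neither the uniform interpolation property (UIP) nor the uniform Lyndon interpolation property (ULIP).
   Context: $\mathcal{L}_{\Box}$: formulas from atoms and $\bot$ with $\wedge,\vee,\to$ and unary $\Box$; $\top:=\bot\to\bot$, $\neg A:=A\to\bot$. A logic is a set of formulas containing all classical tautologies, closed under substitution and modus ponens. $\mathsf{E}$ is the smallest set of formulas containing classical tautologies, closed under modus ponens and the rule from $\phi\leftrightarrow\psi$ infer $\Box\phi\leftrightarrow\Box\psi$. $\mathsf{EC}=\mathsf{E}+(C)$ with (C) $\Box\phi\wedge\Box\psi\to\Box(\phi\wedge\psi)$, and $\mathsf{ECN}=\mathsf{EC}+(N)$ with (N) $\Box\top$ ($+$: add all instances and close under the rules). $V(\phi)$ is the set of atoms in $\phi$. CIP: whenever $L\vdash\phi\to\psi$ there is $\theta$ with $V(\theta)\subseteq V(\phi)\cap V(\psi)$, $L\vdash\phi\to\theta$, $L\vdash\theta\to\psi$. Polarity: $V^+(p)=\{p\}$, $V^-(p)=\varnothing$, $V^{\pm}(\bot)=\varnothing$, $V^{\pm}$ distributes over $\wedge,\vee$, $V^+(\phi\to\psi)=V^-(\phi)\cup V^+(\psi)$, $V^-(\phi\to\psi)=V^+(\phi)\cup V^-(\psi)$, $V^{\pm}(\Box\phi)=V^{\pm}(\phi)$; $p^{\circ}$-free means $p\notin V^{\circ}$. UIP: for every $\phi$ and atom $p$ there are $p$-free $\forall p\,\phi,\exists p\,\phi$ with variables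 among $V(\phi)$ such that $L\vdash\forall p\,\phi\to\phi$, $L\vdash\phi\to\exists p\,\phi$, and for every $p$-free $\psi$: $L\vdash\psi\to\phi$ implies $L\vdash\psi\to\forall p\,\phi$, and $L\vdash\phi\to\psi$ implies $L\vdash\exists p\,\phi\to\psi$. ULIP: for every $\phi$, atom $p$ and $\circ\in\{+,-\}$ there are $p^{\circ}$-free $\forall^{\circ}p\,\phi,\exists^{\circ}p\,\phi$ with $V^{\dagger}(\cdot)\subseteq V^{\dagger}(\phi)$ for $\dagger\in\{+,-\}$ satisfying the same four conditions with "$p^{\circ}$-free $\psi$" in place of "$p$-free $\psi$". -}

module Defs where

open import Data.Nat using (ℕ)
open import Data.Bool using (Bool; true; false; _∧_; _∨_; not)
open import Data.List using (List; []; _∷_; _++_)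
open import Data.List.Membership.Propositional using (_∈_; _∉_)
open import Data.Product using (Σ; ∃; _×_; _,_)
open import Relation.Binary.PropositionalEquality using (_≡_)
open import Relation.Nullary using (¬_)

Atom : Set
Atom = ℕ

infixr 6 _∧ᶠ_
infixr 5 _∨ᶠ_
infixr 4 _⇒_

data Fm : Set where
  var  : Atom → Fm
  ⊥ᶠ   : Fm
  _∧ᶠ_ : Fm → Fm → Fm
  _∨ᶠ_ : Fm → Fm → Fm
  _⇒_  : Fm → Fm → Fm
  □    : Fm → Fm

⊤ᶠ : Fm
⊤ᶠ = ⊥ᶠ ⇒ ⊥ᶠ

¬ᶠ : Fm → Fm
¬ᶠ A = A ⇒ ⊥ᶠ

_⇔_ : Fm → Fm → Fm
A ⇔ B = (A ⇒ B) ∧ᶠ (B ⇒ A)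

-- Classical tautologies: formulas true under every Boolean valuation
-- that treats atoms and boxed formulas as propositional variables
-- (i.e. substitution instances of propositional tautologies).
eval : (Fm → Bool) → Fm → Bool
eval v (var p)  = v (var p)
eval v ⊥ᶠ       = false
eval v (A ∧ᶠ B) = eval v A ∧ eval v B
eval v (A ∨ᶠ B) = eval v A ∨ eval v B
eval v (A ⇒ B)  = not (eval v A) ∨ eval v B
eval v (□ A)    = v (□ A)

Tautology : Fm → Set
Tautology A = (v : Fm → Bool) → eval v A ≡ true

data Deriv (Ax : Fm → Set) : Fm → Set where
  taut : ∀ {A} → Tautology A → Deriv Ax A
  ax   : ∀ {A} → Ax A → Deriv Ax A
  mp   : ∀ {A B} → Deriv Ax (A ⇒ B) → Deriv Ax A → Deriv Ax B
  re   : ∀ {A B} → Deriv Ax (A ⇔ B) → Deriv Ax (□ A ⇔ □ B)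

data AxC : Fm → Set where
  C : ∀ A B → AxC ((□ A ∧ᶠ □ B) ⇒ □ (A ∧ᶠ B))

data AxCN : Fm → Set where
  C : ∀ A B → AxCN ((□ A ∧ᶠ □ B) ⇒ □ (A ∧ᶠ B))
  N : AxCN (□ ⊤ᶠ)

Logic : Set₁
Logic = Fm → Set

EC : Logic
EC = Deriv AxC

ECN : Logic
ECN = Deriv AxCN

V : Fm → List Atom
V (var p)  = p ∷ []
V ⊥ᶠ       = []
V (A ∧ᶠ B) = V A ++ V B
V (A ∨ᶠ B) = V A ++ V B
V (A ⇒ B)  = V A ++ V B
V (□ A)    = V A

data Pol : Set where
  + - : Pol

V± : Pol → Fm → List Atom
V± + (var p)  = p ∷ []
V± - (var p)  = []
V± s ⊥ᶠ       = []
V± s (A ∧ᶠ B) = V± s A ++ V± s B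
V± s (A ∨ᶠ B) = V± s A ++ V± s B
V± + (A ⇒ B)  = V± - A ++ V± + B
V± - (A ⇒ B)  = V± + A ++ V± - B
V± s (□ A)    = V± s A

_⊆_ : List Atom → List Atom → Set
xs ⊆ ys = ∀ {x} → x ∈ xs → x ∈ ys

CIP : Logic → Set
CIP L = ∀ φ ψ → L (φ ⇒ ψ) →
  Σ Fm λ θ → (∀ {x} → x ∈ V θ → x ∈ V φ × x ∈ V ψ)
           × L (φ ⇒ θ) × L (θ ⇒ ψ)

UIP : Logic → Set
UIP L = ∀ φ (p : Atom) →
  Σ Fm λ ∀pφ → Σ Fm λ ∃pφ →
      (p ∉ V ∀pφ) × (p ∉ V ∃pφ)
    × (V ∀pφ ⊆ V φ) × (V ∃pφ ⊆ V φ)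
    × L (∀pφ ⇒ φ) × L (φ ⇒ ∃pφ)
    × (∀ ψ → p ∉ V ψ → L (ψ ⇒ φ) → L (ψ ⇒ ∀pφ))
    × (∀ ψ → p ∉ V ψ → L (φ ⇒ ψ) → L (∃pφ ⇒ ψ))

ULIP : Logic → Set
ULIP L = ∀ φ (p : Atom) (o : Pol) →
  Σ Fm λ ∀pφ → Σ Fm λ ∃pφ →
      (p ∉ V± o ∀pφ) × (p ∉ V± o ∃pφ)
    × (∀ (d : Pol) → V± d ∀pφ ⊆ V± d φ)
    × (∀ (d : Pol) → V± d ∃pφ ⊆ V± d φ)
    × L (∀pφ ⇒ φ) × L (φ ⇒ ∃pφ)
    × (∀ ψ → p ∉ V± o ψ → L (ψ ⇒ φ) → L (ψ ⇒ ∀pφ))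
    × (∀ ψ → p ∉ V± o ψ → L (φ ⇒ ψ) → L (∃pφ ⇒ ψ))

-- The implication □(p ∧ r) → (□(q ∧ ¬r) → □⊥) holds in EC, since C gives
-- □((p ∧ r) ∧ (q ∧ ¬r)) and RE turns this into □⊥.  A Craig interpolant could
-- only use r.  Take four worlds a₁ a₂ b₁ b₂ with p true only at a₁, q only at b₁
-- and r at a₁, a₂, and the two neighbourhood models whose only neighbourhoods
-- are {a₁}, W and {b₁}, W respectively; both validate C and N.  Every r-formula
-- has a truth set that is a union of the blocks {a₁, a₂} and {b₁, b₂}, and on
-- such sets the two models agree, so r-formulas are evaluated identically in
-- both.  But the antecedent holds at a₁ in the first model and the consequent
-- fails at a₁ in the second.  A uniform (Lyndon) interpolant ∃p □(p ∧ r) would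
-- likewise be an r-formula interpolating this implication.
module Submission where

open import Defs
open import Data.Bool using (Bool; true; false; _∧_; _∨_; not)
open import Data.Bool.Properties using (_≟_; ∧-idem; ∧-identityʳ; ∨-zeroʳ)
open import Data.Empty using (⊥; ⊥-elim)
open import Data.List.Membership.Propositional using (_∈_; _∉_)
open import Data.List.Membership.Propositional.Properties using (∈-++⁺ˡ; ∈-++⁺ʳ; ∈-++⁻; ∉[])
open import Data.List.Relation.Unary.Any using (here; there)
open import Data.Product using (_×_; _,_; proj₁; proj₂)
open import Data.Sum using (_⊎_; inj₁; inj₂; [_,_]′; swap)
  renaming (map to ⊎-map)
open import Function using (_∘_; case_of_; mk⇔)
open import Relation.Binary.PropositionalEquality
  using (_≡_; _≢_; _≗_; refl; sym; trans; cong; cong₂; subst)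
open import Relation.Nullary using (¬_; Dec; does; yes; no)
open import Relation.Nullary.Decidable using (map′; _×-dec_; dec-true; dec-false; does-⇔)

⇒ᵇ-intro : ∀ {a b} → (a ≡ true → b ≡ true) → not a ∨ b ≡ true
⇒ᵇ-intro {true}  h = h refl
⇒ᵇ-intro {false} h = refl

⇒ᵇ-elim : ∀ {a b} → not a ∨ b ≡ true → a ≡ true → b ≡ true
⇒ᵇ-elim {true} h refl = h

∧ᵇ-intro : ∀ {a b} → a ≡ true → b ≡ true → a ∧ b ≡ true
∧ᵇ-intro refl refl = refl

∧ᵇ-elim : ∀ {a b} → a ∧ b ≡ true → a ≡ true × b ≡ true
∧ᵇ-elim {true} {true} _ = refl , refl

⇔ᵇ⇒≡ : ∀ {a b} → (not a ∨ b) ∧ (not b ∨ a) ≡ true → a ≡ b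
⇔ᵇ⇒≡ {true}  {true}  _ = refl
⇔ᵇ⇒≡ {false} {false} _ = refl

≡⇒⇔ᵇ : ∀ {a b} → a ≡ b → (not a ∨ b) ∧ (not b ∨ a) ≡ true
≡⇒⇔ᵇ {true}  refl = refl
≡⇒⇔ᵇ {false} refl = refl

∈V⇒∈V± : ∀ θ {x} → x ∈ V θ → x ∈ V± + θ ⊎ x ∈ V± - θ
∈V⇒∈V± (var _)  m = inj₁ m
∈V⇒∈V± (A ∧ᶠ B) m = [ ⊎-map ∈-++⁺ˡ ∈-++⁺ˡ ∘ ∈V⇒∈V± A
                    , ⊎-map (∈-++⁺ʳ _) (∈-++⁺ʳ _) ∘ ∈V⇒∈V± B ]′ (∈-++⁻ (V A) m)
∈V⇒∈V± (A ∨ᶠ B) m = [ ⊎-map ∈-++⁺ˡ ∈-++⁺ˡ ∘ ∈V⇒∈V± A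
                    , ⊎-map (∈-++⁺ʳ _) (∈-++⁺ʳ _) ∘ ∈V⇒∈V± B ]′ (∈-++⁻ (V A) m)
∈V⇒∈V± (A ⇒ B)  m = [ ⊎-map ∈-++⁺ˡ ∈-++⁺ˡ ∘ swap ∘ ∈V⇒∈V± A
                    , ⊎-map (∈-++⁺ʳ _) (∈-++⁺ʳ _) ∘ ∈V⇒∈V± B ]′ (∈-++⁻ (V A) m)
∈V⇒∈V± (□ A)    m = ∈V⇒∈V± A m

Contains-C : (Fm → Set) → Set
Contains-C Ax = ∀ A B → Ax ((□ A ∧ᶠ □ B) ⇒ □ (A ∧ᶠ B))

contradiction-taut : ∀ A B D → Tautology (((A ∧ᶠ B) ∧ᶠ (D ∧ᶠ ¬ᶠ B)) ⇔ ⊥ᶠ)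
contradiction-taut A B D v with eval v A | eval v B | eval v D
... | false | _     | _     = refl
... | true  | false | _     = refl
... | true  | true  | false = refl
... | true  | true  | true  = refl

C-RE-taut : ∀ A B → Tautology (((□ A ∧ᶠ □ B) ⇒ □ (A ∧ᶠ B)) ⇒
                               ((□ (A ∧ᶠ B) ⇔ □ ⊥ᶠ) ⇒ (□ A ⇒ (□ B ⇒ □ ⊥ᶠ))))
C-RE-taut A B v with v (□ A) | v (□ B) | v (□ (A ∧ᶠ B)) | v (□ ⊥ᶠ)
... | true  | true  | false | _     = refl
... | true  | true  | true  | false = refl
... | true  | true  | true  | true  = refl
... | true  | false | false | false = refl
... | true  | false | false | true  = refl
... | true  | false | true  | false = refl
... | true  | false | true  | true  = refl
... | false | _     | false | false = refl
... | false | _     | false | true  = refl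
... | false | _     | true  | false = refl
... | false | _     | true  | true  = refl

□-contradiction : ∀ {Ax} → Contains-C Ax → ∀ {A B} →
  Deriv Ax ((A ∧ᶠ B) ⇔ ⊥ᶠ) → Deriv Ax (□ A ⇒ (□ B ⇒ □ ⊥ᶠ))
□-contradiction hasC {A} {B} d = mp (mp (taut (C-RE-taut A B)) (ax (hasC A B))) (re d)

data World : Set where
  a₁ a₂ b₁ b₂ : World

Subset : Set
Subset = World → Bool

full : Subset
full _ = true

_∩_ : Subset → Subset → Subset
(X ∩ Y) w = X w ∧ Y w

∩-cong : ∀ {X X′ Y Y′} → X ≗ X′ → Y ≗ Y′ → X ∩ Y ≗ X′ ∩ Y′
∩-cong eX eY w = cong₂ _∧_ (eX w) (eY w)

_≟ˢ_ : (X Y : Subset) → Dec (X ≗ Y)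
X ≟ˢ Y = map′ (λ (e₁ , e₂ , e₃ , e₄) → λ { a₁ → e₁ ; a₂ → e₂ ; b₁ → e₃ ; b₂ → e₄ })
              (λ e → e a₁ , e a₂ , e b₁ , e b₂)
              (X a₁ ≟ Y a₁ ×-dec X a₂ ≟ Y a₂ ×-dec X b₁ ≟ Y b₁ ×-dec X b₂ ≟ Y b₂)

pattern p = 0
pattern q = 1
pattern r = 2

⁅a₁⁆ ⁅b₁⁆ ⁅a₁,a₂⁆ : Subset
⁅a₁⁆ a₁ = true
⁅a₁⁆ _  = false
⁅b₁⁆ b₁ = true
⁅b₁⁆ _  = false
⁅a₁,a₂⁆ a₁ = true
⁅a₁,a₂⁆ a₂ = true
⁅a₁,a₂⁆ _  = false

val : Atom → Subset
val p = ⁅a₁⁆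
val q = ⁅b₁⁆
val r = ⁅a₁,a₂⁆
val _ = λ _ → false

Respects≗ : (Subset → Bool) → Set
Respects≗ ν = ∀ {X Y} → X ≗ Y → ν X ≡ ν Y

⟦_⟧ : Fm → (Subset → Bool) → Subset
⟦ var x  ⟧ ν w = val x w
⟦ ⊥ᶠ     ⟧ ν w = false
⟦ A ∧ᶠ B ⟧ ν w = ⟦ A ⟧ ν w ∧ ⟦ B ⟧ ν w
⟦ A ∨ᶠ B ⟧ ν w = ⟦ A ⟧ ν w ∨ ⟦ B ⟧ ν w
⟦ A ⇒ B  ⟧ ν w = not (⟦ A ⟧ ν w) ∨ ⟦ B ⟧ ν w
⟦ □ A    ⟧ ν w = ν (⟦ A ⟧ ν)

Valid : (Subset → Bool) → Fm → Set
Valid ν A = ∀ w → ⟦ A ⟧ ν w ≡ true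

eval-⟦⟧ : ∀ ν w A → eval (λ B → ⟦ B ⟧ ν w) A ≡ ⟦ A ⟧ ν w
eval-⟦⟧ ν w (var x)  = refl
eval-⟦⟧ ν w ⊥ᶠ       = refl
eval-⟦⟧ ν w (A ∧ᶠ B) = cong₂ _∧_ (eval-⟦⟧ ν w A) (eval-⟦⟧ ν w B)
eval-⟦⟧ ν w (A ∨ᶠ B) = cong₂ _∨_ (eval-⟦⟧ ν w A) (eval-⟦⟧ ν w B)
eval-⟦⟧ ν w (A ⇒ B)  = cong₂ (λ a b → not a ∨ b) (eval-⟦⟧ ν w A) (eval-⟦⟧ ν w B)
eval-⟦⟧ ν w (□ A)    = refl

sound : ∀ {Ax ν} → Respects≗ ν → (∀ {A} → Ax A → Valid ν A) →
        ∀ {A} → Deriv Ax A → Valid ν A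
sound {ν = ν} resp valid (taut {A} t) w = trans (sym (eval-⟦⟧ ν w A)) (t _)
sound resp valid (ax a)  w = valid a w
sound resp valid (mp d e) w = ⇒ᵇ-elim (sound resp valid d w) (sound resp valid e w)
sound resp valid (re d)  w = ≡⇒⇔ᵇ (resp (⇔ᵇ⇒≡ ∘ sound resp valid d))

ν⟨_⟩ : Subset → Subset → Bool
ν⟨ S ⟩ X = does (X ≟ˢ S) ∨ does (X ≟ˢ full)

ν⟨⟩-respects≗ : ∀ S → Respects≗ ν⟨ S ⟩
ν⟨⟩-respects≗ S {X} {Y} X≗Y = cong₂ _∨_ (same S) (same full)
  where
  same : ∀ Z → does (X ≟ˢ Z) ≡ does (Y ≟ˢ Z)
  same Z = does-⇔ (mk⇔ (λ X≗Z w → trans (sym (X≗Y w)) (X≗Z w))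
                       (λ Y≗Z w → trans (X≗Y w) (Y≗Z w)))
                  (X ≟ˢ Z) (Y ≟ˢ Z)

does-∨ : ∀ {A B : Set} (a? : Dec A) (b? : Dec B) → does a? ∨ does b? ≡ true → A ⊎ B
does-∨ (yes a) _       _ = inj₁ a
does-∨ (no _)  (yes b) _ = inj₂ b

ν⟨⟩-true⇒ : ∀ S X → ν⟨ S ⟩ X ≡ true → X ≗ S ⊎ X ≗ full
ν⟨⟩-true⇒ S X = does-∨ (X ≟ˢ S) (X ≟ˢ full)

ν⟨⟩-self : ∀ S → ν⟨ S ⟩ S ≡ true
ν⟨⟩-self S = cong (_∨ does (S ≟ˢ full)) (dec-true (S ≟ˢ S) (λ _ → refl))

ν⟨⟩-full : ∀ S → ν⟨ S ⟩ full ≡ true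
ν⟨⟩-full S = ∨-zeroʳ (does (full ≟ˢ S))

ν⟨⟩-true⇐ : ∀ S X → X ≗ S ⊎ X ≗ full → ν⟨ S ⟩ X ≡ true
ν⟨⟩-true⇐ S X (inj₁ X≗S) = trans (ν⟨⟩-respects≗ S X≗S) (ν⟨⟩-self S)
ν⟨⟩-true⇐ S X (inj₂ X≗W) = trans (ν⟨⟩-respects≗ S X≗W) (ν⟨⟩-full S)

pair-∩-closed : ∀ {S X Y} → X ≗ S ⊎ X ≗ full → Y ≗ S ⊎ Y ≗ full → X ∩ Y ≗ S ⊎ X ∩ Y ≗ full
pair-∩-closed {S} (inj₁ X≗S) (inj₁ Y≗S) = inj₁ λ w → trans (∩-cong X≗S Y≗S w) (∧-idem (S w))
pair-∩-closed {S} (inj₁ X≗S) (inj₂ Y≗W) = inj₁ λ w → trans (∩-cong X≗S Y≗W w) (∧-identityʳ (S w))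
pair-∩-closed     (inj₂ X≗W) (inj₁ Y≗S) = inj₁ (∩-cong X≗W Y≗S)
pair-∩-closed     (inj₂ X≗W) (inj₂ Y≗W) = inj₂ (∩-cong X≗W Y≗W)

ν⟨⟩-∩ : ∀ S X Y → ν⟨ S ⟩ X ≡ true → ν⟨ S ⟩ Y ≡ true → ν⟨ S ⟩ (X ∩ Y) ≡ true
ν⟨⟩-∩ S X Y hX hY =
  ν⟨⟩-true⇐ S (X ∩ Y) (pair-∩-closed (ν⟨⟩-true⇒ S X hX) (ν⟨⟩-true⇒ S Y hY))

C-valid : ∀ ν → (∀ X Y → ν X ≡ true → ν Y ≡ true → ν (X ∩ Y) ≡ true) →
          ∀ A B → Valid ν ((□ A ∧ᶠ □ B) ⇒ □ (A ∧ᶠ B))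
C-valid ν ∩-closed A B w = ⇒ᵇ-intro λ h → let (hA , hB) = ∧ᵇ-elim h in ∩-closed _ _ hA hB

AxCN-valid : ∀ S {A} → AxCN A → Valid ν⟨ S ⟩ A
AxCN-valid S (C A B) = C-valid ν⟨ S ⟩ (ν⟨⟩-∩ S) A B
AxCN-valid S N       w = ν⟨⟩-full S

AxC-valid : ∀ S {A} → AxC A → Valid ν⟨ S ⟩ A
AxC-valid S (C A B) = AxCN-valid S (C A B)

Blockwise : Subset → Set
Blockwise X = X a₁ ≡ X a₂ × X b₁ ≡ X b₂

Blockwise-resp : ∀ {X Y} → X ≗ Y → Blockwise X → Blockwise Y
Blockwise-resp X≗Y (e₁ , e₂) =
  trans (sym (X≗Y a₁)) (trans e₁ (X≗Y a₂)) , trans (sym (X≗Y b₁)) (trans e₂ (X≗Y b₂))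

ν⟨⟩-on-blockwise : ∀ S X → ¬ Blockwise S → Blockwise X → ν⟨ S ⟩ X ≡ does (X ≟ˢ full)
ν⟨⟩-on-blockwise S X S-not-blockwise X-blockwise =
  cong (_∨ does (X ≟ˢ full))
       (dec-false (X ≟ˢ S) (λ X≗S → S-not-blockwise (Blockwise-resp X≗S X-blockwise)))

⁅a₁⁆-not-blockwise : ¬ Blockwise ⁅a₁⁆
⁅a₁⁆-not-blockwise ()

⁅b₁⁆-not-blockwise : ¬ Blockwise ⁅b₁⁆
⁅b₁⁆-not-blockwise (_ , ())

ν⟨a₁⟩≡ν⟨b₁⟩-on-blockwise : ∀ X → Blockwise X → ν⟨ ⁅a₁⁆ ⟩ X ≡ ν⟨ ⁅b₁⁆ ⟩ X
ν⟨a₁⟩≡ν⟨b₁⟩-on-blockwise X X-blockwise =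
  trans (ν⟨⟩-on-blockwise ⁅a₁⁆ X ⁅a₁⁆-not-blockwise X-blockwise)
        (sym (ν⟨⟩-on-blockwise ⁅b₁⁆ X ⁅b₁⁆-not-blockwise X-blockwise))

Indistinguishable : Subset → Subset → Set
Indistinguishable X Y = X ≗ Y × Blockwise X

indistinguishable-pointwise : ∀ (f : Bool → Bool → Bool) {X X′ Y Y′} →
  Indistinguishable X X′ → Indistinguishable Y Y′ →
  Indistinguishable (λ w → f (X w) (Y w)) (λ w → f (X′ w) (Y′ w))
indistinguishable-pointwise f (eX , bX₁ , bX₂) (eY , bY₁ , bY₂) =
  (λ w → cong₂ f (eX w) (eY w)) , cong₂ f bX₁ bY₁ , cong₂ f bX₂ bY₂

blockwise-invariance : ∀ {ν ν′} → (∀ X → Blockwise X → ν X ≡ ν′ X) → Respects≗ ν′ →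
  ∀ θ → (∀ {x} → x ∈ V θ → Blockwise (val x)) → Indistinguishable (⟦ θ ⟧ ν) (⟦ θ ⟧ ν′)
blockwise-invariance agree resp (var x)  atoms = (λ _ → refl) , atoms (here refl)
blockwise-invariance agree resp ⊥ᶠ       atoms = (λ _ → refl) , refl , refl
blockwise-invariance agree resp (A ∧ᶠ B) atoms = indistinguishable-pointwise _∧_
  (blockwise-invariance agree resp A (atoms ∘ ∈-++⁺ˡ))
  (blockwise-invariance agree resp B (atoms ∘ ∈-++⁺ʳ (V A)))
blockwise-invariance agree resp (A ∨ᶠ B) atoms = indistinguishable-pointwise _∨_
  (blockwise-invariance agree resp A (atoms ∘ ∈-++⁺ˡ))
  (blockwise-invariance agree resp B (atoms ∘ ∈-++⁺ʳ (V A)))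
blockwise-invariance agree resp (A ⇒ B)  atoms = indistinguishable-pointwise (λ a b → not a ∨ b)
  (blockwise-invariance agree resp A (atoms ∘ ∈-++⁺ˡ))
  (blockwise-invariance agree resp B (atoms ∘ ∈-++⁺ʳ (V A)))
blockwise-invariance {ν} {ν′} agree resp (□ A) atoms =
  (λ _ → trans (agree (⟦ A ⟧ ν) A-blockwise) (resp A≗A′)) , refl , refl
  where
  A≗A′ = proj₁ (blockwise-invariance agree resp A atoms)
  A-blockwise = proj₂ (blockwise-invariance agree resp A atoms)

φ ψ : Fm
φ = □ (var p ∧ᶠ var r)
ψ = □ (var q ∧ᶠ ¬ᶠ (var r)) ⇒ □ ⊥ᶠ

φ⇒ψ : ∀ {Ax} → Contains-C Ax → Deriv Ax (φ ⇒ ψ)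
φ⇒ψ hasC = □-contradiction hasC (taut (contradiction-taut (var p) (var r) (var q)))

EC-like : (Fm → Set) → Set
EC-like Ax = Contains-C Ax × (∀ S {A} → Ax A → Valid ν⟨ S ⟩ A)

EC-like-AxC : EC-like AxC
EC-like-AxC = AxC.C , AxC-valid

EC-like-AxCN : EC-like AxCN
EC-like-AxCN = AxCN.C , AxCN-valid

no-r-interpolant : ∀ {Ax} → EC-like Ax → ∀ θ → (∀ {x} → x ∈ V θ → x ≡ r) →
                   Deriv Ax (φ ⇒ θ) → Deriv Ax (θ ⇒ ψ) → ⊥
no-r-interpolant {Ax} (_ , valid) θ only-r φ⇒θ θ⇒ψ = case ψ-holds-in-ν⟨b₁⟩ of λ ()
  where
  sound⟨_⟩ : ∀ S {A} → Deriv Ax A → Valid ν⟨ S ⟩ A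
  sound⟨ S ⟩ = sound (ν⟨⟩-respects≗ S) (valid S)

  θ-holds-in-ν⟨a₁⟩ : ⟦ θ ⟧ ν⟨ ⁅a₁⁆ ⟩ a₁ ≡ true
  θ-holds-in-ν⟨a₁⟩ = ⇒ᵇ-elim (sound⟨ ⁅a₁⁆ ⟩ φ⇒θ a₁) refl

  θ-indistinguishable : Indistinguishable (⟦ θ ⟧ ν⟨ ⁅a₁⁆ ⟩) (⟦ θ ⟧ ν⟨ ⁅b₁⁆ ⟩)
  θ-indistinguishable = blockwise-invariance ν⟨a₁⟩≡ν⟨b₁⟩-on-blockwise (ν⟨⟩-respects≗ ⁅b₁⁆) θ
    (λ m → subst (Blockwise ∘ val) (sym (only-r m)) (refl , refl))

  θ-holds-in-ν⟨b₁⟩ : ⟦ θ ⟧ ν⟨ ⁅b₁⁆ ⟩ a₁ ≡ true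
  θ-holds-in-ν⟨b₁⟩ = trans (sym (proj₁ θ-indistinguishable a₁)) θ-holds-in-ν⟨a₁⟩

  ψ-holds-in-ν⟨b₁⟩ : ⟦ ψ ⟧ ν⟨ ⁅b₁⁆ ⟩ a₁ ≡ true
  ψ-holds-in-ν⟨b₁⟩ = ⇒ᵇ-elim (sound⟨ ⁅b₁⁆ ⟩ θ⇒ψ a₁) θ-holds-in-ν⟨b₁⟩

φ-atom-≢p : ∀ {x} → x ∈ V φ → x ≢ p → x ≡ r
φ-atom-≢p (here x≡p)         x≢p = ⊥-elim (x≢p x≡p)
φ-atom-≢p (there (here x≡r)) _   = x≡r

common-atom : ∀ {x} → x ∈ V φ → x ∈ V ψ → x ≡ r
common-atom (there (here x≡r)) _                  = x≡r
common-atom (here refl)        (here ())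
common-atom (here refl)        (there (here ()))

p∉Vψ : p ∉ V ψ
p∉Vψ (there (here ()))

p∉V⁺ψ : p ∉ V± + ψ
p∉V⁺ψ (here ())

¬CIP : ∀ {Ax} → EC-like Ax → ¬ CIP (Deriv Ax)
¬CIP ec cip =
  let (θ , common , φ⇒θ , θ⇒ψ) = cip φ ψ (φ⇒ψ (proj₁ ec))
  in no-r-interpolant ec θ (λ m → let (mφ , mψ) = common m in common-atom mφ mψ) φ⇒θ θ⇒ψ

¬UIP : ∀ {Ax} → EC-like Ax → ¬ UIP (Deriv Ax)
¬UIP ec uip =
  let (_ , θ , _ , p∉θ , _ , θ⊆φ , _ , φ⇒θ , _ , θ-least) = uip φ p
      only-r : ∀ {x} → x ∈ V θ → x ≡ r
      only-r m = φ-atom-≢p (θ⊆φ m) λ { refl → p∉θ m }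
  in no-r-interpolant ec θ only-r φ⇒θ (θ-least ψ p∉Vψ (φ⇒ψ (proj₁ ec)))

¬ULIP : ∀ {Ax} → EC-like Ax → ¬ ULIP (Deriv Ax)
¬ULIP ec ulip =
  let (_ , θ , _ , p∉θ , _ , θ⊆φ , _ , φ⇒θ , _ , θ-least) = ulip φ p +
      only-r : ∀ {x} → x ∈ V θ → x ≡ r
      only-r m = [ (λ m⁺ → φ-atom-≢p (θ⊆φ + m⁺) λ { refl → p∉θ m⁺ })
                 , (λ m⁻ → ⊥-elim (∉[] (θ⊆φ - m⁻))) ]′ (∈V⇒∈V± θ m)
  in no-r-interpolant ec θ only-r φ⇒θ (θ-least ψ p∉V⁺ψ (φ⇒ψ (proj₁ ec)))

mainTheorem6 : (¬ CIP EC × ¬ CIP ECN) × (¬ UIP EC × ¬ UIP ECN) × (¬ ULIP EC × ¬ ULIP ECN)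
mainTheorem6 =
  (¬CIP EC-like-AxC , ¬CIP EC-like-AxCN) ,
  (¬UIP EC-like-AxC , ¬UIP EC-like-AxCN) ,
  (¬ULIP EC-like-AxC , ¬ULIP EC-like-AxCN)
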